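{- Let $\mathcal{A}^*$ be a deterministic external memory algorithm for the permutation problem (defined in the context) that makes at most $t$ I/Os on every input and whose output is incorrect on at most half of all $n!\,2^{nw}$ possible input arrays (i.e. error probability at most $1/2$ over a uniformly random permutation $\pi$ and independent uniformly random $d_1,\dots,d_n$). Then there exists a set $\Gamma$ of at least $$\frac{n!\,2^{nw}}{2\left(t+n(w+\lg n)/b+nw/b+1\right)^{t+1}}$$ distinct input arrays such that $\mathcal{A}^*$ is correct on every $A\in\Gamma$ and the I/O-graph of $\mathcal{A}^*$ is the same for all $A\in\Gamma$.
   Context: External memory model: internal memory of $m$ bits, unbounded disk partitioned into blocks of $b$ bits; an I/O reads or writes one block; cost is number of I/Os; computation in memory is free and unrestricted. Permutation problem: input is a permutation $\pi$ of $\{1,\dots,n\}$ and bit strings $d_1,\dots,d_n\in\{0,1\}^w$, with $w\ge\lg n$, given as an array $A$ whose $i$-th entry stores $(\pi(i),d_i)$ ($\pi(i)$ encoded in $\lceil\lg n\rceil$ bits), packed $b/(w+\lg n)$ entries per block (assume $(w+\lg n)$ divides $b$), so $A$ occupies $n(w+\lg n)/b$ blocks. There is an initially empty output array $C$ of $n$ words of $w$ bits, packed $b/w$ per block ($nw/b$ blocks). The goal is to store $d_i$ in $C[\pi(i)]$ for all $i$. I/O-graph of a deterministic algorithm on an input: start with one block node per disk block of $A$, one block node per disk block of $C$, and one memory node; all nodes are live, and block nodes get distinct integer labels. Process the I/Os of the execution in order. If the I/O is the first access to a disk block not belonging to $A$ or $C$, create a new live block node with a fresh label and add a directed edge from the live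 memory node to it. Otherwise let $v$ be the live block node of that disk block; add an edge from $v$ to the live memory node, mark $v$ dead, create a new live block node $v'$ with the same label as $v$, and add an edge from the live memory node to $v'$. In addition, after every $m/b$ I/Os, mark the memory node dead, create a new live memory node, and add a directed edge from the old memory node to the new one. -}

module Defs where

open import Data.Nat using (ℕ; zero; suc; _+_; _*_; _∸_; _/_; _%_; _<ᵇ_; _≡ᵇ_; _<?_; _^_; pred; NonZero)
open import Data.Nat.Logarithm using (⌈log₂_⌉)
open import Data.Bool using (Bool; true; false; if_then_else_)
open import Data.Fin using (Fin; toℕ; fromℕ<)
open import Relation.Nullary using (yes; no)
open import Data.Vec using (Vec; lookup; tabulate; replicate)
open import Data.List using (List; []; _∷_; _++_; [_])
open import Data.Maybe using (Maybe; just; nothing)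
open import Data.Product using (_×_; _,_; proj₁; proj₂)
open import Relation.Binary.PropositionalEquality using (_≡_)
open import Data.Empty using (⊥)
open import Data.Unit using (⊤)
open import Data.Nat.DivMod using (m%n<n)

Bits : ℕ → Set
Bits k = Vec Bool k

Disk : ℕ → Set
Disk b = ℕ → Bits b

updateDisk : ∀ {b} → Disk b → ℕ → Bits b → Disk b
updateDisk D a x j = if j ≡ᵇ a then x else D j

-- Computation in memory is free: in every memory
-- state the algorithm decides (deterministically) its next action.
--   * halt
--   * read a g   : read disk block a; new memory = g (contents of block a)
--   * write a x s: write x into disk block a; new memory = s
-- (the new memory state may depend arbitrarily on the old one, since the
--  action is itself chosen as a function of the old memory).

data Action (m b : ℕ) : Set where
  halt  : Action m b
  read  : ℕ → (Bits b → Bits m) → Action m b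
  write : ℕ → Bits b → Bits m → Action m b

Algorithm : ℕ → ℕ → Set
Algorithm m b = Bits m → Action m b

run : ∀ {m b} → Algorithm m b → ℕ → Bits m → Disk b → Maybe (Disk b × List ℕ)
run alg k mem D with alg mem
... | halt = just (D , [])
run alg zero    mem D | read a g = nothing
run alg (suc k) mem D | read a g with run alg k (g (D a)) D
... | nothing = nothing
... | just (D' , tr) = just (D' , a ∷ tr)
run alg zero    mem D | write a x s = nothing
run alg (suc k) mem D | write a x s with run alg k s (updateDisk D a x)
... | nothing = nothing
... | just (D' , tr) = just (D' , a ∷ tr)

lgn : ℕ → ℕ
lgn n = ⌈log₂ n ⌉

-- the j-th bit (little-endian, j = 0 least significant) of the binary
-- encoding of x
bitOf : ℕ → ℕ → Bool
bitOf x zero = x % 2 ≡ᵇ 1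
bitOf x (suc j) = bitOf (x / 2) j

-- An input: π given as the vector (π(1),…,π(n)) (values 0-based, i.e.
-- Fin n), and the data d_1,…,d_n.
Input : ℕ → ℕ → Set
Input n w = Vec (Fin n) n × Vec (Bits w) n

IsPerm : ∀ {n} → Vec (Fin n) n → Set
IsPerm {n} π = (i j : Fin n) → lookup π i ≡ lookup π j → i ≡ j

blocksA : (n w b : ℕ) → .{{NonZero b}} → ℕ
blocksA n w b = (n * (w + lgn n)) / b

blocksC : (n w b : ℕ) → .{{NonZero b}} → ℕ
blocksC n w b = (n * w) / b

-- bit number p of the array A: entry i = (π(i), d_i) occupies bits
-- i(w+lg n) … (i+1)(w+lg n)-1, first the ⌈lg n⌉-bit encoding of π(i),
-- then the w bits of d_i.
bitA : (n w : ℕ) → Input n w → ℕ → Bool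
bitA n w (π , d) p = entry (p / K) (p % K)
  where
  ℓ = lgn n
  -- K = w + ℓ whenever w + ℓ ≥ 1 (guaranteed by the hypotheses of the
  -- lemma, since (w + ℓ) ∣ b with b ≥ 1); written this way only so that
  -- division is total.
  K = suc (pred (w + ℓ))
  dataBit : Bits w → ℕ → Bool
  dataBit v r with r <? w
  ... | yes r<w = lookup v (fromℕ< r<w)
  ... | no _ = false
  entry : ℕ → ℕ → Bool
  entry i o with i <? n
  ... | no _ = false
  ... | yes i<n =
    if o <ᵇ ℓ then bitOf (toℕ (lookup π (fromℕ< i<n))) o
    else dataBit (lookup d (fromℕ< i<n)) (o ∸ ℓ)

-- initial disk: blocks 0 … blocksA-1 hold A; everything else (C and the
-- scratch space) is initially empty (all zeros)
initDisk : (n w b : ℕ) → .{{NonZero b}} → Input n w → Disk b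
initDisk n w b inp j with j <? blocksA n w b
... | yes _ = tabulate (λ r → bitA n w inp (j * b + toℕ r))
... | no _  = replicate b false

initMem : (m : ℕ) → Bits m
initMem m = replicate m false

bitC : (n w b : ℕ) → .{{NonZero b}} → Disk b → ℕ → Bool
bitC n w b D q = lookup (D (blocksA n w b + q / b)) (fromℕ< (m%n<n q b))

OutputCorrect : (n w b : ℕ) → .{{NonZero b}} → Input n w → Disk b → Set
OutputCorrect n w b (π , d) D =
  (i : Fin n) (r : Fin w) →
  bitC n w b D (toℕ (lookup π i) * w + toℕ r) ≡ lookup (lookup d i) r

HaltsWithin : ∀ {m b} → Algorithm m b → (n w t : ℕ) → .{{NonZero b}} → Input n w → Set
HaltsWithin {m} {b} alg n w t inp with run alg t (initMem m) (initDisk n w b inp)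
... | just _  = ⊤
... | nothing = ⊥

Correct : ∀ {m b} → Algorithm m b → (n w t : ℕ) → .{{NonZero b}} → Input n w → Set
Correct {m} {b} alg n w t inp with run alg t (initMem m) (initDisk n w b inp)
... | just (D , _) = OutputCorrect n w b inp D
... | nothing      = ⊥

-- Block nodes are  blk ℓ v  (label ℓ, v-th node carrying that label);
-- memory nodes are  mem k  (the k-th memory node).  Labels: the disk
-- blocks of A and C (addresses 0 … base-1, base = blocksA + blocksC)
-- get labels 0 … base-1; each other disk block gets the next fresh label
-- base, base+1, … upon its first access.  The initial nodes
-- (blk ℓ 0 for ℓ < base, and mem 0) are the same for all inputs; the
-- graph is represented by its list of edges, in order of creation.

data Node : Set where
  blk : ℕ → ℕ → Node
  mem : ℕ → Node

Edges : Set
Edges = List (Node × Node)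

record GState : Set where
  field
    labels : List (ℕ × ℕ)   -- scratch disk address ↦ label
    fresh  : ℕ
    ver    : ℕ → ℕ          -- live node of label ℓ is  blk ℓ (ver ℓ)
    memk   : ℕ              -- live memory node is  mem memk
    cnt    : ℕ              -- I/Os since the last memory-node change
    edges  : Edges

lookupLabel : ℕ → List (ℕ × ℕ) → Maybe ℕ
lookupLabel a [] = nothing
lookupLabel a ((x , l) ∷ xs) = if a ≡ᵇ x then just l else lookupLabel a xs

-- process one I/O to disk address a; base = number of blocks of A and C,
-- M = m / b
ioStep : (base M : ℕ) → GState → ℕ → GState
ioStep base M s a = tick (access (if a <ᵇ base then just a else lookupLabel a labels))
  where
  open GState s
  access : Maybe ℕ → GState
  access nothing = record s
    { labels = (a , fresh) ∷ labels
    ; fresh  = suc fresh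
    ; edges  = edges ++ [ (mem memk , blk fresh 0) ] }
  access (just l) = record s
    { ver   = λ l' → if l' ≡ᵇ l then suc (ver l) else ver l'
    ; edges = edges ++ ((blk l (ver l) , mem memk) ∷ (mem memk , blk l (suc (ver l))) ∷ []) }
  tick : GState → GState
  tick s' = if suc (GState.cnt s') ≡ᵇ M
    then record s' { cnt = 0 ; memk = suc (GState.memk s')
                   ; edges = GState.edges s' ++ [ (mem (GState.memk s') , mem (suc (GState.memk s'))) ] }
    else record s' { cnt = suc (GState.cnt s') }

ioGraphFrom : (base M : ℕ) → GState → List ℕ → Edges
ioGraphFrom base M s [] = GState.edges s
ioGraphFrom base M s (a ∷ as) = ioGraphFrom base M (ioStep base M s a) as

ioGraphOfTrace : (base M : ℕ) → List ℕ → Edges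
ioGraphOfTrace base M = ioGraphFrom base M
  (record { labels = [] ; fresh = base ; ver = λ _ → 0 ; memk = 0 ; cnt = 0 ; edges = [] })

ioGraph : ∀ {m b} → Algorithm m b → (n w t : ℕ) → .{{NonZero b}} → Input n w → Maybe Edges
ioGraph {m} {b} alg n w t inp with run alg t (initMem m) (initDisk n w b inp)
... | just (_ , tr) = just (ioGraphOfTrace (blocksA n w b + blocksC n w b) (m / b) tr)
... | nothing = nothing

-- The I/O-graph of a run depends
-- only on its sequence of access codes: 0 for the first access to a scratch block, 1 + ℓ for an
-- access to the block labelled ℓ; the addresses merely decide which labels recur. With
-- base = (number of blocks of A and C), fewer than base + i labels exist before the i-th I/O, so
-- a run of at most t I/Os has one of at most (t + base + 1)^t code sequences, hence graphs, and
-- by pigeonhole one graph is shared by a 1/(t + base + 1)^t fraction of the correct inputs.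

module Submission where

open import Defs
open import Data.Nat using (ℕ; _!; _+_; _*_; _^_; _≤_; NonZero)
open import Data.Nat.Divisibility using (_∣_)
open import Data.List using (List; length)
open import Data.List.Relation.Unary.All using (All)
open import Data.List.Relation.Unary.Unique.Propositional using (Unique)
open import Data.Maybe using (just)
open import Data.Product using (Σ; ∃; _×_; proj₁)
open import Relation.Nullary using (¬_)
open import Relation.Binary.PropositionalEquality using (_≡_)

open import Data.Nat using (zero; suc; _<_; _<ᵇ_; _≡ᵇ_; _/_; z≤n; s≤s)
open import Data.Nat.Properties
open import Data.Bool as Bool using (true; false; if_then_else_; T)
open import Data.Fin using (Fin; zero; suc; punchIn)
open import Data.Fin.Properties using (all?; punchIn-injective; punchInᵢ≢i)
open import Data.Vec as Vec using (Vec; []; _∷_; lookup)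
open import Data.Vec.Properties using (∷-injective; lookup-map)
open import Data.List using ([]; _∷_; _++_; [_]; map; filter; upTo; allFin; cartesianProductWith; cartesianProduct)
open import Data.List.Properties using (length-++; length-map; length-upTo; length-tabulate)
open import Data.List.Membership.Propositional using (_∈_)
open import Data.List.Membership.Propositional.Properties using (∈-map⁺; ∈-map⁻; ∈-upTo⁺; ∈-cartesianProductWith⁺)
open import Data.List.Relation.Unary.Any using (here; there)
open import Data.List.Relation.Unary.All as All using ([]; _∷_)
open import Data.List.Relation.Unary.All.Properties as All using (all-filter)
open import Data.List.Relation.Unary.AllPairs using ([]; _∷_)
import Data.List.Relation.Unary.Unique.Propositional.Properties as Unique
open import Data.List.Relation.Binary.Sublist.Propositional.Properties using (filter-⊆; filter⁺; length-mono-≤)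
import Data.List.Properties as List
import Data.Maybe.Properties as Maybe
import Data.Product.Properties as Product
open import Data.Maybe using (Maybe; nothing; maybe)
open import Data.Product using (_,_; proj₂)
open import Data.Sum using (inj₁; inj₂)
open import Data.Empty using (⊥-elim)
open import Function using (_∘_; id)
open import Relation.Nullary using (yes; no; map′; _×-dec_)
open import Relation.Unary using (Decidable)
open import Relation.Unary.Properties using (∁?)
open import Relation.Binary.Definitions using (DecidableEquality)
open import Relation.Binary.PropositionalEquality using (refl; sym; trans; cong; cong₂; subst; setoid; module ≡-Reasoning)

private
  variable
    A B C : Set

length-cartesianProductWith : (f : A → B → C) (xs : List A) (ys : List B) →
  length (cartesianProductWith f xs ys) ≡ length xs * length ys
length-cartesianProductWith f [] ys = refl
length-cartesianProductWith f (x ∷ xs) ys = begin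
  length (map (f x) ys ++ cartesianProductWith f xs ys)      ≡⟨ length-++ (map (f x) ys) ⟩
  length (map (f x) ys) + length (cartesianProductWith f xs ys)
    ≡⟨ cong₂ _+_ (length-map (f x) ys) (length-cartesianProductWith f xs ys) ⟩
  length ys + length xs * length ys                          ∎
  where open ≡-Reasoning

module _ {P : A → Set} (P? : Decidable P) where

  length-filter+filter-∁ : ∀ xs → length (filter P? xs) + length (filter (∁? P?) xs) ≡ length xs
  length-filter+filter-∁ [] = refl
  length-filter+filter-∁ (x ∷ xs) with P? x
  ... | yes _ = cong suc (length-filter+filter-∁ xs)
  ... | no _  = trans (+-suc _ _) (cong suc (length-filter+filter-∁ xs))

  length≤2*length-filter : ∀ xs → 2 * length (filter (∁? P?) xs) ≤ length xs →
    length xs ≤ 2 * length (filter P? xs)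
  length≤2*length-filter xs few∁ = begin
    length xs  ≡⟨ sym (length-filter+filter-∁ xs) ⟩
    p + q      ≤⟨ +-monoʳ-≤ p q≤p ⟩
    p + p      ≡⟨ cong (p +_) (sym (+-identityʳ p)) ⟩
    2 * p      ∎
    where
    open ≤-Reasoning
    p q : ℕ
    p = length (filter P? xs)
    q = length (filter (∁? P?) xs)
    q≤p : q ≤ p
    q≤p = +-cancelʳ-≤ q q p (begin
      q + q        ≡⟨ cong (q +_) (sym (+-identityʳ q)) ⟩
      2 * q        ≤⟨ few∁ ⟩
      length xs    ≡⟨ sym (length-filter+filter-∁ xs) ⟩
      p + q        ∎)

module _ (f : A → B) (_≟_ : DecidableEquality B) where

  fiber fiberᶜ : B → List A → List A
  fiber  s = filter (λ x → f x ≟ s)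
  fiberᶜ s = filter (∁? (λ x → f x ≟ s))

  fiber-fiberᶜ-≤ : ∀ s s′ xs → length (fiber s′ (fiberᶜ s xs)) ≤ length (fiber s′ xs)
  fiber-fiberᶜ-≤ s s′ xs = length-mono-≤ (filter⁺ _ _ (λ { refl fx≡s′ → fx≡s′ }) (filter-⊆ _ xs))

  length≡fiber+fiberᶜ : ∀ s xs → length xs ≡ length (fiber s xs) + length (fiberᶜ s xs)
  length≡fiber+fiberᶜ s xs = sym (length-filter+filter-∁ (λ x → f x ≟ s) xs)

  larger-fiber : ∀ s s′ xs k → length (fiberᶜ s xs) ≤ k * length (fiber s′ (fiberᶜ s xs)) →
    ∃ λ s″ → length xs ≤ suc k * length (fiber s″ xs)
  larger-fiber s s′ xs k fiberᶜ≤ with ≤-total (length (fiber s xs)) (length (fiber s′ xs))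
  ... | inj₁ p≤q = s′ , (begin
    length xs                               ≡⟨ length≡fiber+fiberᶜ s xs ⟩
    length (fiber s xs) + length (fiberᶜ s xs)
      ≤⟨ +-mono-≤ p≤q (≤-trans fiberᶜ≤ (*-monoʳ-≤ k (fiber-fiberᶜ-≤ s s′ xs))) ⟩
    suc k * length (fiber s′ xs)            ∎)
    where open ≤-Reasoning
  ... | inj₂ q≤p = s , (begin
    length xs                               ≡⟨ length≡fiber+fiberᶜ s xs ⟩
    length (fiber s xs) + length (fiberᶜ s xs)
      ≤⟨ +-monoʳ-≤ _ (≤-trans fiberᶜ≤ (*-monoʳ-≤ k (≤-trans (fiber-fiberᶜ-≤ s s′ xs) q≤p))) ⟩
    suc k * length (fiber s xs)             ∎)
    where open ≤-Reasoning

  pigeonhole : (default : B) (S : List B) (xs : List A) → All (λ x → f x ∈ S) xs →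
    ∃ λ s → length xs ≤ length S * length (fiber s xs)
  pigeonhole default [] [] [] = default , z≤n
  pigeonhole default (s ∷ S) xs f∈ =
    let s′ , fiberᶜ≤ = pigeonhole default S (fiberᶜ s xs) fiberᶜ∈S in larger-fiber s s′ xs (length S) fiberᶜ≤
    where
    fiberᶜ∈S : All (λ x → f x ∈ S) (fiberᶜ s xs)
    fiberᶜ∈S = All.zipWith (λ { (here fx≡s , fx≢s) → ⊥-elim (fx≢s fx≡s) ; (there fx∈S , _) → fx∈S })
      (All.filter⁺ (∁? (λ x → f x ≟ s)) f∈ , all-filter (∁? (λ x → f x ≟ s)) xs)

map-injective : ∀ {f : A → B} → (∀ {x y} → f x ≡ f y → x ≡ y) →
  ∀ {k} {xs ys : Vec A k} → Vec.map f xs ≡ Vec.map f ys → xs ≡ ys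
map-injective f-inj {xs = []} {[]} _ = refl
map-injective f-inj {xs = x ∷ xs} {y ∷ ys} eq =
  let x≡y , xs≡ys = ∷-injective eq in cong₂ _∷_ (f-inj x≡y) (map-injective f-inj xs≡ys)

vectors : List A → (n : ℕ) → List (Vec A n)
vectors xs zero = [ [] ]
vectors xs (suc n) = cartesianProductWith _∷_ xs (vectors xs n)

vectors-unique : ∀ {xs : List A} → Unique xs → ∀ n → Unique (vectors xs n)
vectors-unique xs! zero = [] ∷ []
vectors-unique xs! (suc n) = Unique.cartesianProductWith⁺ _∷_ ∷-injective xs! (vectors-unique xs! n)

length-vectors : (xs : List A) (n : ℕ) → length (vectors xs n) ≡ length xs ^ n
length-vectors xs zero = refl
length-vectors xs (suc n) =
  trans (length-cartesianProductWith _∷_ xs (vectors xs n)) (cong (length xs *_) (length-vectors xs n))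

consPerm : ∀ {n} → Fin (suc n) → Vec (Fin n) n → Vec (Fin (suc n)) (suc n)
consPerm k π = k ∷ Vec.map (punchIn k) π

consPerm-injective : ∀ {n} {k k′ : Fin (suc n)} {π π′} → consPerm k π ≡ consPerm k′ π′ → k ≡ k′ × π ≡ π′
consPerm-injective {k = k} eq with ∷-injective eq
... | refl , map≡ = refl , map-injective (punchIn-injective k _ _) map≡

consPerm-isPerm : ∀ {n} k (π : Vec (Fin n) n) → IsPerm π → IsPerm (consPerm k π)
consPerm-isPerm k π π-inj zero    zero    eq = refl
consPerm-isPerm k π π-inj zero    (suc j) eq =
  ⊥-elim (punchInᵢ≢i k (lookup π j) (sym (trans eq (lookup-map j (punchIn k) π))))
consPerm-isPerm k π π-inj (suc i) zero    eq =
  ⊥-elim (punchInᵢ≢i k (lookup π i) (trans (sym (lookup-map i (punchIn k) π)) eq))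
consPerm-isPerm k π π-inj (suc i) (suc j) eq = cong suc (π-inj i j (punchIn-injective k _ _
  (trans (sym (lookup-map i (punchIn k) π)) (trans eq (lookup-map j (punchIn k) π)))))

permutations : (n : ℕ) → List (Vec (Fin n) n)
permutations zero = [ [] ]
permutations (suc n) = cartesianProductWith consPerm (allFin (suc n)) (permutations n)

permutations-unique : ∀ n → Unique (permutations n)
permutations-unique zero = [] ∷ []
permutations-unique (suc n) =
  Unique.cartesianProductWith⁺ consPerm consPerm-injective (Unique.allFin⁺ (suc n)) (permutations-unique n)

permutations-isPerm : ∀ n → All IsPerm (permutations n)
permutations-isPerm zero = (λ ()) ∷ []
permutations-isPerm (suc n) =
  All.cartesianProductWith⁺ (setoid _) (setoid _) {P = IsPerm} consPerm (allFin (suc n)) (permutations n)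
    (λ {k} {π} _ π∈ → consPerm-isPerm k π (All.lookup (permutations-isPerm n) π∈))

length-permutations : ∀ n → length (permutations n) ≡ n !
length-permutations zero = refl
length-permutations (suc n) = begin
  length (cartesianProductWith consPerm (allFin (suc n)) (permutations n))
    ≡⟨ length-cartesianProductWith consPerm (allFin (suc n)) (permutations n) ⟩
  length (allFin (suc n)) * length (permutations n)
    ≡⟨ cong₂ _*_ (length-tabulate {n = suc n} id) (length-permutations n) ⟩
  suc n * n !  ∎
  where open ≡-Reasoning

bitStrings : (w : ℕ) → List (Bits w)
bitStrings = vectors (true ∷ false ∷ [])

inputs : (n w : ℕ) → List (Input n w)
inputs n w = cartesianProduct (permutations n) (vectors (bitStrings w) n)

inputs-unique : ∀ n w → Unique (inputs n w)
inputs-unique n w = Unique.cartesianProduct⁺ (permutations-unique n)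
  (vectors-unique (vectors-unique (((λ ()) ∷ []) ∷ [] ∷ []) w) n)

inputs-isPerm : ∀ n w → All (IsPerm ∘ proj₁) (inputs n w)
inputs-isPerm n w = All.cartesianProduct⁺ (setoid _) (setoid _) {P = IsPerm ∘ proj₁} _ _
  (λ π∈ _ → All.lookup (permutations-isPerm n) π∈)

length-inputs : ∀ n w → length (inputs n w) ≡ n ! * 2 ^ (n * w)
length-inputs n w = begin
  length (inputs n w)
    ≡⟨ length-cartesianProductWith _,_ (permutations n) (vectors (bitStrings w) n) ⟩
  length (permutations n) * length (vectors (bitStrings w) n)
    ≡⟨ cong₂ _*_ (length-permutations n) (length-vectors (bitStrings w) n) ⟩
  n ! * length (bitStrings w) ^ n  ≡⟨ cong (λ k → n ! * k ^ n) (length-vectors (true ∷ false ∷ []) w) ⟩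
  n ! * (2 ^ w) ^ n                ≡⟨ cong (n ! *_) (^-*-assoc 2 w n) ⟩
  n ! * 2 ^ (w * n)                ≡⟨ cong (λ k → n ! * 2 ^ k) (*-comm w n) ⟩
  n ! * 2 ^ (n * w)                ∎
  where open ≡-Reasoning

shortLists : ℕ → ℕ → List (List ℕ)
shortLists zero    a = [ [] ]
shortLists (suc k) a = [] ∷ cartesianProductWith _∷_ (upTo a) (shortLists k a)

∈-shortLists : ∀ k a xs → length xs ≤ k → All (_< a) xs → xs ∈ shortLists k a
∈-shortLists zero    a []       _         _          = here refl
∈-shortLists (suc k) a []       _         _          = here refl
∈-shortLists (suc k) a (x ∷ xs) (s≤s len≤) (x<a ∷ xs<a) =
  there (∈-cartesianProductWith⁺ _∷_ (∈-upTo⁺ x<a) (∈-shortLists k a xs len≤ xs<a))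

length-shortLists : ∀ k a → length (shortLists k a) ≤ suc a ^ k
length-shortLists zero    a = ≤-refl
length-shortLists (suc k) a = begin
  suc (length (cartesianProductWith _∷_ (upTo a) (shortLists k a)))
    ≡⟨ cong suc (trans (length-cartesianProductWith _∷_ (upTo a) (shortLists k a))
                       (cong (_* length (shortLists k a)) (length-upTo a))) ⟩
  suc (a * length (shortLists k a))  ≤⟨ s≤s (*-monoʳ-≤ a (length-shortLists k a)) ⟩
  suc (a * suc a ^ k)                ≤⟨ +-monoˡ-≤ (a * suc a ^ k) (m^n>0 (suc a) k) ⟩
  suc a ^ k + a * suc a ^ k          ∎
  where open ≤-Reasoning

module _ (M : ℕ) where

  -- ioStep with the accessed label already resolved into an access code; the table of
  -- scratch-block labels is neither consulted nor extended.
  replayStep : GState → ℕ → GState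
  replayStep s c = tick (access c)
    where
    open GState s
    access : ℕ → GState
    access zero = record s
      { fresh = suc fresh
      ; edges = edges ++ [ (mem memk , blk fresh 0) ] }
    access (suc l) = record s
      { ver   = λ l' → if l' ≡ᵇ l then suc (ver l) else ver l'
      ; edges = edges ++ ((blk l (ver l) , mem memk) ∷ (mem memk , blk l (suc (ver l))) ∷ []) }
    tick : GState → GState
    tick s' = if suc (GState.cnt s') ≡ᵇ M
      then record s' { cnt = 0 ; memk = suc (GState.memk s')
                     ; edges = GState.edges s' ++ [ (mem (GState.memk s') , mem (suc (GState.memk s'))) ] }
      else record s' { cnt = suc (GState.cnt s') }

  replay : GState → List ℕ → Edges
  replay s [] = GState.edges s
  replay s (c ∷ cs) = replay (replayStep s c) cs

forgetLabels : GState → GState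
forgetLabels s = record s { labels = [] }

initGState : ℕ → GState
initGState base = record { labels = [] ; fresh = base ; ver = λ _ → 0 ; memk = 0 ; cnt = 0 ; edges = [] }

module _ (base M : ℕ) where

  liveLabel : GState → ℕ → Maybe ℕ
  liveLabel s a = if a <ᵇ base then just a else lookupLabel a (GState.labels s)

  accessCode : GState → ℕ → ℕ
  accessCode s a = maybe suc 0 (liveLabel s a)

  forgetLabels-ioStep : ∀ s a →
    forgetLabels (ioStep base M s a) ≡ replayStep M (forgetLabels s) (accessCode s a)
  forgetLabels-ioStep s a with liveLabel s a
  ... | nothing with suc (GState.cnt s) ≡ᵇ M
  ...   | true  = refl
  ...   | false = refl
  forgetLabels-ioStep s a | just l with suc (GState.cnt s) ≡ᵇ M
  ...   | true  = refl
  ...   | false = refl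

  labelCodes : GState → List ℕ → List ℕ
  labelCodes s [] = []
  labelCodes s (a ∷ as) = accessCode s a ∷ labelCodes (ioStep base M s a) as

  length-labelCodes : ∀ s tr → length (labelCodes s tr) ≡ length tr
  length-labelCodes s [] = refl
  length-labelCodes s (a ∷ as) = cong suc (length-labelCodes (ioStep base M s a) as)

  ioGraphFrom≡replay : ∀ s tr → ioGraphFrom base M s tr ≡ replay M (forgetLabels s) (labelCodes s tr)
  ioGraphFrom≡replay s [] = refl
  ioGraphFrom≡replay s (a ∷ as) =
    trans (ioGraphFrom≡replay (ioStep base M s a) as)
          (cong (λ r → replay M r (labelCodes (ioStep base M s a) as)) (forgetLabels-ioStep s a))

  LabelsBelowFresh : GState → Set
  LabelsBelowFresh s = All (λ p → proj₂ p < GState.fresh s) (GState.labels s) × base ≤ GState.fresh s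

  lookupLabel-< : ∀ {f l} a ls → All (λ p → proj₂ p < f) ls → lookupLabel a ls ≡ just l → l < f
  lookupLabel-< a ((x , y) ∷ ls) (y<f ∷ ys<f) eq with a ≡ᵇ x
  ... | true  with refl ← eq = y<f
  ... | false = lookupLabel-< a ls ys<f eq

  accessCode≤fresh : ∀ s a → LabelsBelowFresh s → accessCode s a ≤ GState.fresh s
  accessCode≤fresh s a (ls<f , base≤f) with a <ᵇ base in a<base
  ... | true = ≤-trans (<ᵇ⇒< a base (subst T (sym a<base) _)) base≤f
  ... | false with lookupLabel a (GState.labels s) in found
  ...   | nothing = z≤n
  ...   | just l  = lookupLabel-< a (GState.labels s) ls<f found

  ioStep-labelsBelowFresh : ∀ s a → LabelsBelowFresh s →
    LabelsBelowFresh (ioStep base M s a) × GState.fresh (ioStep base M s a) ≤ suc (GState.fresh s)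
  ioStep-labelsBelowFresh s a inv@(ls<f , base≤f) with liveLabel s a
  ... | nothing with suc (GState.cnt s) ≡ᵇ M
  ...   | true  = (n<1+n _ ∷ All.map m<n⇒m<1+n ls<f , m≤n⇒m≤1+n base≤f) , ≤-refl
  ...   | false = (n<1+n _ ∷ All.map m<n⇒m<1+n ls<f , m≤n⇒m≤1+n base≤f) , ≤-refl
  ioStep-labelsBelowFresh s a inv | just l with suc (GState.cnt s) ≡ᵇ M
  ...   | true  = inv , n≤1+n _
  ...   | false = inv , n≤1+n _

  labelCodes-< : ∀ s tr → LabelsBelowFresh s → All (_< length tr + GState.fresh s) (labelCodes s tr)
  labelCodes-< s [] inv = []
  labelCodes-< s (a ∷ as) inv with ioStep-labelsBelowFresh s a inv
  ... | inv′ , fresh′≤ =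
    s≤s (≤-trans (accessCode≤fresh s a inv) (m≤n+m _ _))
    ∷ All.map (λ c< → ≤-trans c< (≤-trans (+-monoʳ-≤ (length as) fresh′≤) (≤-reflexive (+-suc _ _))))
              (labelCodes-< (ioStep base M s a) as inv′)

  traceGraphs : ℕ → List Edges
  traceGraphs t = map (replay M (initGState base)) (shortLists t (t + base))

  ioGraphOfTrace∈traceGraphs : ∀ t tr → length tr ≤ t → ioGraphOfTrace base M tr ∈ traceGraphs t
  ioGraphOfTrace∈traceGraphs t tr tr≤t =
    subst (_∈ traceGraphs t) (sym (ioGraphFrom≡replay s₀ tr)) (∈-map⁺ _ codes∈)
    where
    s₀ : GState
    s₀ = initGState base
    codes∈ : labelCodes s₀ tr ∈ shortLists t (t + base)
    codes∈ = ∈-shortLists t (t + base) (labelCodes s₀ tr)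
      (subst (_≤ t) (sym (length-labelCodes s₀ tr)) tr≤t)
      (All.map (λ c< → ≤-trans c< (+-monoˡ-≤ base tr≤t)) (labelCodes-< s₀ tr ([] , ≤-refl)))

  length-traceGraphs : ∀ t → length (traceGraphs t) ≤ suc (t + base) ^ t
  length-traceGraphs t = subst (_≤ _) (sym (length-map _ (shortLists t (t + base))))
    (length-shortLists t (t + base))

length-run : ∀ {m b} (alg : Algorithm m b) k memory D {D′ tr} → run alg k memory D ≡ just (D′ , tr) → length tr ≤ k
length-run alg k memory D eq with alg memory
... | halt with refl ← eq = z≤n
length-run alg (suc k) memory D eq | read a g with run alg k (g (D a)) D in eq′
... | just _ with refl ← eq = s≤s (length-run alg k (g (D a)) D eq′)
length-run alg (suc k) memory D eq | write a x s with run alg k s (updateDisk D a x) in eq′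
... | just _ with refl ← eq = s≤s (length-run alg k s (updateDisk D a x) eq′)

_≟ᴺ_ : DecidableEquality Node
blk l v ≟ᴺ blk l′ v′ = map′ (λ (l≡ , v≡) → cong₂ blk l≡ v≡) (λ { refl → refl , refl }) (l ≟ l′ ×-dec v ≟ v′)
blk _ _ ≟ᴺ mem _    = no λ ()
mem _   ≟ᴺ blk _ _  = no λ ()
mem k   ≟ᴺ mem k′   = map′ (cong mem) (λ { refl → refl }) (k ≟ k′)

_≟ᴳ_ : DecidableEquality (Maybe Edges)
_≟ᴳ_ = Maybe.≡-dec (List.≡-dec (Product.≡-dec _≟ᴺ_ _≟ᴺ_))

module _ {m b : ℕ} (alg : Algorithm m b) (n w t : ℕ) .{{_ : NonZero b}} where

  correct? : Decidable (Correct alg n w t)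
  correct? inp with run alg t (initMem m) (initDisk n w b inp)
  ... | nothing = no λ ()
  ... | just _  = all? λ _ → all? λ _ → _ Bool.≟ _

  base : ℕ
  base = blocksA n w b + blocksC n w b

  possibleGraphs : List (Maybe Edges)
  possibleGraphs = map just (traceGraphs base (m / b) t)

  ioGraph∈possibleGraphs : ∀ inp → Correct alg n w t inp → ioGraph alg n w t inp ∈ possibleGraphs
  ioGraph∈possibleGraphs inp _ with run alg t (initMem m) (initDisk n w b inp) in ran
  ... | just (_ , tr) = ∈-map⁺ just (ioGraphOfTrace∈traceGraphs base (m / b) t tr
                          (length-run alg t (initMem m) (initDisk n w b inp) ran))

  length-possibleGraphs : length possibleGraphs ≤ (t + blocksA n w b + blocksC n w b + 1) ^ (t + 1)
  length-possibleGraphs = begin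
    length possibleGraphs                    ≡⟨ length-map just (traceGraphs base (m / b) t) ⟩
    length (traceGraphs base (m / b) t)      ≤⟨ length-traceGraphs base (m / b) t ⟩
    suc (t + base) ^ t                       ≤⟨ ^-monoʳ-≤ (suc (t + base)) (m≤m+n t 1) ⟩
    suc (t + base) ^ (t + 1)                 ≡⟨ cong (_^ (t + 1)) suc[t+base]≡ ⟩
    (t + blocksA n w b + blocksC n w b + 1) ^ (t + 1) ∎
    where
    open ≤-Reasoning
    suc[t+base]≡ : suc (t + base) ≡ t + blocksA n w b + blocksC n w b + 1
    suc[t+base]≡ = trans (+-comm 1 (t + base)) (cong (_+ 1) (sym (+-assoc t _ _)))

  fiber-sameGraph : ∀ g {Γ} → All (λ inp → ioGraph alg n w t inp ≡ g) Γ → All (Correct alg n w t) Γ →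
    ∃ λ G → All (λ inp → ioGraph alg n w t inp ≡ just G) Γ
  fiber-sameGraph (just G) same _ = G , same
  fiber-sameGraph nothing [] [] = [] , []
  fiber-sameGraph nothing {inp ∷ _} (≡nothing ∷ _) (correct ∷ _)
    with ∈-map⁻ _ (subst (_∈ possibleGraphs) ≡nothing (ioGraph∈possibleGraphs inp correct))
  ... | _ , _ , ()

lemma3 : (n w b m t : ℕ) .{{_ : NonZero b}} →
    lgn n ≤ w → (w + lgn n) ∣ b → w ∣ b →
    b ∣ n * (w + lgn n) → b ∣ n * w → b ∣ m → b ≤ m →
    (alg : Algorithm m b) →
    ((inp : Input n w) → IsPerm (proj₁ inp) → HaltsWithin alg n w t inp) →
    ((L : List (Input n w)) → Unique L →
      All (λ inp → IsPerm (proj₁ inp) × ¬ Correct alg n w t inp) L →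
      2 * length L ≤ (n !) * 2 ^ (n * w)) →
    Σ (List (Input n w)) λ Γ →
      Unique Γ ×
      All (λ inp → IsPerm (proj₁ inp) × Correct alg n w t inp) Γ ×
      (∃ λ G → All (λ inp → ioGraph alg n w t inp ≡ just G) Γ) ×
      (n !) * 2 ^ (n * w)
        ≤ 2 * length Γ * (t + blocksA n w b + blocksC n w b + 1) ^ (t + 1)
-- Correct already includes halting within t I/Os, and the count does not depend on the block
-- layout, so only the error bound among the hypotheses is needed.
lemma3 n w b m t _ _ _ _ _ _ _ alg _ fewErrors =
  Γ , Unique.filter⁺ _ (Unique.filter⁺ _ (inputs-unique n w)) , Γ-good ,
  fiber-sameGraph alg n w t g (all-filter _ corrects) (All.map proj₂ Γ-good) , N≤
  where
  open ≤-Reasoning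
  ok? : Decidable (Correct alg n w t)
  ok? = correct? alg n w t

  graph : Input n w → Maybe Edges
  graph = ioGraph alg n w t

  N K : ℕ
  N = n ! * 2 ^ (n * w)
  K = (t + blocksA n w b + blocksC n w b + 1) ^ (t + 1)

  corrects errors : List (Input n w)
  corrects = filter ok? (inputs n w)
  errors   = filter (∁? ok?) (inputs n w)

  corrects-good : All (λ inp → IsPerm (proj₁ inp) × Correct alg n w t inp) corrects
  corrects-good = All.zip (All.filter⁺ ok? (inputs-isPerm n w) , all-filter ok? (inputs n w))

  N≤2*corrects : N ≤ 2 * length corrects
  N≤2*corrects = subst (_≤ 2 * length corrects) (length-inputs n w)
    (length≤2*length-filter ok? (inputs n w) (subst (2 * length errors ≤_) (sym (length-inputs n w))
      (fewErrors errors (Unique.filter⁺ _ (inputs-unique n w))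
        (All.zip (All.filter⁺ (∁? ok?) (inputs-isPerm n w) , all-filter (∁? ok?) (inputs n w))))))

  crowded : ∃ λ g → length corrects ≤ length (possibleGraphs alg n w t) * length (fiber graph _≟ᴳ_ g corrects)
  crowded = pigeonhole graph _≟ᴳ_ nothing (possibleGraphs alg n w t) corrects
    (All.map (ioGraph∈possibleGraphs alg n w t _ ∘ proj₂) corrects-good)

  g : Maybe Edges
  g = proj₁ crowded

  Γ : List (Input n w)
  Γ = fiber graph _≟ᴳ_ g corrects

  Γ-good : All (λ inp → IsPerm (proj₁ inp) × Correct alg n w t inp) Γ
  Γ-good = All.filter⁺ _ corrects-good

  N≤ : N ≤ 2 * length Γ * K
  N≤ = begin
    N                                              ≤⟨ N≤2*corrects ⟩
    2 * length corrects                            ≤⟨ *-monoʳ-≤ 2 (proj₂ crowded) ⟩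
    2 * (length (possibleGraphs alg n w t) * length Γ)
      ≤⟨ *-monoʳ-≤ 2 (*-monoˡ-≤ (length Γ) (length-possibleGraphs alg n w t)) ⟩
    2 * (K * length Γ)                             ≡⟨ cong (2 *_) (*-comm K (length Γ)) ⟩
    2 * (length Γ * K)                             ≡⟨ sym (*-assoc 2 (length Γ) K) ⟩
    2 * length Γ * K                               ∎
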